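{- Let $t\in Y_n$ be a tree whose $i$th leaf is right oriented, for some $2\le i\le n-1$. If $w\in Y_n$ satisfies $w\le t$, then the $i$th leaf of $w$ is right oriented too.
   Context: $Y_n$: planar binary rooted trees with $n$ internal vertices, with $n+1$ leaves numbered $1,\dots,n+1$ from left to right; a leaf is right oriented (SW–NE) if it is the right child of its parent vertex and left oriented if it is the left child. Grafting $u\vee v$: join roots of $u$ (left) and $v$ (right) to a new vertex and add a new root. Weak order on $Y_n$: generated reflexively and transitively by (a) $u\le u'$, $v\le v'$ imply $u\vee v\le u'\vee v'$; (b) $(u\vee v)\vee w\le u\vee(v\vee w)$ for all trees $u,v,w$. -}

module Defs where

open import Data.Nat using (ℕ; zero; suc; _+_)
open import Data.List using (List; []; _∷_; _++_)
open import Data.Maybe using (Maybe; just; nothing)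

-- Planar binary rooted trees; `leaf` is the tree with 0 internal vertices,
-- `u ∨ v` is grafting (u on the left, v on the right, new root added).
data Tree : Set where
  leaf : Tree
  _∨_  : Tree → Tree → Tree

infixr 6 _∨_

-- number of internal vertices (t ∈ Y_n  iff  size t ≡ n)
size : Tree → ℕ
size leaf    = zero
size (u ∨ v) = suc (size u + size v)

data Side : Set where
  left right : Side

-- orientations of the leaves of a subtree which is the `s`-child of its parent
sides : Side → Tree → List Side
sides s leaf    = s ∷ []
sides s (u ∨ v) = sides left u ++ sides right v

-- orientations of the leaves of t, listed left to right
-- (the one-leaf tree has a leaf with no parent vertex: empty list)
leafSides : Tree → List Side
leafSides leaf    = []
leafSides (u ∨ v) = sides left u ++ sides right v

-- 1-indexed lookup
nth : {A : Set} → List A → ℕ → Maybe A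
nth []       _             = nothing
nth (x ∷ xs) zero          = nothing
nth (x ∷ xs) (suc zero)    = just x
nth (x ∷ xs) (suc (suc k)) = nth xs (suc k)

RightOriented : Tree → ℕ → Set
RightOriented t i = nth (leafSides t) i ≡ just right
  where open import Relation.Binary.PropositionalEquality using (_≡_)

data _≤T_ : Tree → Tree → Set where
  ≤-refl  : ∀ {t} → t ≤T t
  ≤-trans : ∀ {s t r} → s ≤T t → t ≤T r → s ≤T r
  ≤-graft : ∀ {u u' v v'} → u ≤T u' → v ≤T v' → (u ∨ v) ≤T (u' ∨ v')
  ≤-assoc : ∀ {u v w} → ((u ∨ v) ∨ w) ≤T (u ∨ (v ∨ w))

{-# OPTIONS --safe #-}
module Submission where

-- Read leaf orientations left to right. A rotation (u ∨ v) ∨ w ↦ u ∨ (v ∨ w)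
-- changes at most one of them: when v is a single leaf it turns from right to
-- left oriented, and nothing else moves. Hence, ordering the orientations by
-- right ⊑ left, the orientation list is antitone along the weak order, so a
-- leaf that is right oriented in t is right oriented in every w ≤ t.

open import Defs
open import Data.Nat using (ℕ; _≤_; suc; zero)
open import Data.List using (List; []; _∷_; _++_)
open import Data.List.Properties using (++-assoc)
open import Data.List.Relation.Binary.Pointwise as Pointwise
  using (Pointwise; []; _∷_; ++⁺)
import Data.Maybe.Relation.Binary.Pointwise as Maybe
open import Data.Maybe using (just)
open import Relation.Binary.Definitions using (Reflexive; Transitive)
open import Relation.Binary.PropositionalEquality using (_≡_; refl; subst; sym)

infix 4 _⊑_ _⊑*_

data _⊑_ : Side → Side → Set where
  right⊑ : ∀ {s} → right ⊑ s
  left⊑left : left ⊑ left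

⊑-refl : Reflexive _⊑_
⊑-refl {left}  = left⊑left
⊑-refl {right} = right⊑

⊑-trans : Transitive _⊑_
⊑-trans right⊑     _        = right⊑
⊑-trans left⊑left left⊑left = left⊑left

_⊑*_ : List Side → List Side → Set
_⊑*_ = Pointwise _⊑_

⊑*-refl : Reflexive _⊑*_
⊑*-refl = Pointwise.refl ⊑-refl

⊑*-trans : Transitive _⊑*_
⊑*-trans = Pointwise.transitive ⊑-trans

nth⁺ : ∀ {xs ys} → xs ⊑* ys → ∀ i → Maybe.Pointwise _⊑_ (nth xs i) (nth ys i)
nth⁺ []                   i             = Maybe.nothing
nth⁺ (_ ∷ _)              zero          = Maybe.nothing
nth⁺ (x⊑y ∷ _)            (suc zero)    = Maybe.just x⊑y
nth⁺ (_ ∷ [])             (suc (suc i)) = Maybe.nothing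
nth⁺ (_ ∷ xs⊑ys@(_ ∷ _))  (suc (suc i)) = nth⁺ xs⊑ys (suc i)

⊑-just-right : ∀ {m} → Maybe.Pointwise _⊑_ m (just right) → m ≡ just right
⊑-just-right (Maybe.just right⊑) = refl

sides-right⊑left : ∀ t → sides right t ⊑* sides left t
sides-right⊑left leaf    = right⊑ ∷ []
sides-right⊑left (_ ∨ _) = ⊑*-refl

sides-assoc : ∀ u v w → sides left ((u ∨ v) ∨ w) ⊑* sides left (u ∨ (v ∨ w))
sides-assoc u v w =
  subst (_⊑* sides left u ++ sides left v ++ sides right w)
    (sym (++-assoc (sides left u) (sides right v) (sides right w)))
    (++⁺ (⊑*-refl {sides left u}) (++⁺ (sides-right⊑left v) ⊑*-refl))

sides-antitone : ∀ s {w t} → w ≤T t → sides s w ⊑* sides s t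
sides-antitone s ≤-refl        = ⊑*-refl
sides-antitone s (≤-trans p q) = ⊑*-trans (sides-antitone s p) (sides-antitone s q)
sides-antitone s (≤-graft p q) = ++⁺ (sides-antitone left p) (sides-antitone right q)
sides-antitone s (≤-assoc {u} {v} {w}) = sides-assoc u v w

≤T-leaf : ∀ {w t} → w ≤T t → w ≡ leaf → t ≡ leaf
≤T-leaf ≤-refl        w≡leaf = w≡leaf
≤T-leaf (≤-trans p q) w≡leaf = ≤T-leaf q (≤T-leaf p w≡leaf)
≤T-leaf (≤-graft _ _) ()
≤T-leaf ≤-assoc       ()

rightOriented-antitone : ∀ {w t} → w ≤T t → ∀ i → RightOriented t i → RightOriented w i
rightOriented-antitone {t = leaf} _ _ ()
rightOriented-antitone {leaf} {_ ∨ _} w≤t _ _ with ≤T-leaf w≤t refl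
... | ()
rightOriented-antitone {_ ∨ _} {_ ∨ _} w≤t i ro =
  ⊑-just-right (subst (Maybe.Pointwise _⊑_ _) ro (nth⁺ (sides-antitone left w≤t) i))

lemma3p4 : (n : ℕ) (t w : Tree) → size t ≡ n → size w ≡ n →
    (i : ℕ) → 2 ≤ i → suc i ≤ n →
    RightOriented t i → w ≤T t → RightOriented w i
lemma3p4 _ _ _ _ _ i _ _ ro w≤t = rightOriented-antitone w≤t i ro
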